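{- Let $k\ge2$ and $n\ge1$ be integers and let $\lambda\in\Lambda_k$. Then for each $j\in\{1,2\}$ the following are equivalent: (i) $(n^k,(n+j)^k)\cap\mathcal{S}_{\{\lambda\}}\neq\varnothing$; (ii) $\#\bigl((n^k,(n+j)^k)\cap\mathcal{S}_{\{\lambda\}}\bigr)=1$; (iii) $\{n/\lambda\}>1-j/\lambda$, where $\{x\}$ denotes the fractional part of $x$.
   Context: $\Lambda_k$ denotes the set of real numbers $(b_1^{k+1}b_2^{k+2}\cdots b_{k-1}^{2k-1})^{1/k}$ where $b_1,\dots,b_{k-1}$ are positive integers with $b_1\cdots b_{k-1}\ge2$ and $b_1\cdots b_{k-1}$ squarefree (all such numbers exceed $2$). For $\lambda\in\Lambda_k$, $\mathcal{S}_{\{\lambda\}}:=\{a^k\lambda^k : a\in\mathbb{Z}_{\ge1}\}$. -}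

module Defs where

open import Data.Nat using (ℕ; zero; suc; _+_; _*_; _∸_; _^_; _≤_; _<_)
open import Data.Nat.Divisibility using (_∣_)
open import Data.Fin using (Fin; toℕ) renaming (zero to fzero; suc to fsuc)
open import Data.Product using (Σ; _×_; ∃)
open import Relation.Binary.PropositionalEquality using (_≡_)

prodFin : (m : ℕ) → (Fin m → ℕ) → ℕ
prodFin zero    f = 1
prodFin (suc m) f = f fzero * prodFin m (λ i → f (fsuc i))

SquareFree : ℕ → Set
SquareFree x = ∀ d → d * d ∣ x → d ≡ 1

-- Parameters b₁,…,b_{k-1} of an element of Λ_k, given as b : Fin (k ∸ 1) → ℕ
-- (index i : Fin (k ∸ 1) stands for b_{i+1}).
InΛParams : (k : ℕ) → (Fin (k ∸ 1) → ℕ) → Set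
InΛParams k b = (∀ i → 1 ≤ b i) × 2 ≤ prodFin (k ∸ 1) b × SquareFree (prodFin (k ∸ 1) b)

-- λ^k = b₁^{k+1} b₂^{k+2} ⋯ b_{k-1}^{2k-1}  (a positive integer); λ is its
-- positive real k-th root.
λpow : (k : ℕ) → (Fin (k ∸ 1) → ℕ) → ℕ
λpow k b = prodFin (k ∸ 1) (λ i → b i ^ (k + suc (toℕ i)))

InS : (k L s : ℕ) → Set
InS k L s = Σ ℕ (λ a → 1 ≤ a × s ≡ a ^ k * L)

-- s ∈ (n^k, (n+j)^k) ∩ S_{λ}, where L = λ^k
InWindow : (k L n j s : ℕ) → Set
InWindow k L n j s = n ^ k < s × s < (n + j) ^ k × InS k L s

Nonempty : (k L n j : ℕ) → Set
Nonempty k L n j = Σ ℕ (λ s → InWindow k L n j s)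

CardOne : (k L n j : ℕ) → Set
CardOne k L n j = Σ ℕ (λ s → InWindow k L n j s × (∀ t → InWindow k L n j t → t ≡ s))

-- m = ⌊n/λ⌋ with λ = L^{1/k} > 0, expressed exactly: m·λ ≤ n < (m+1)·λ,
-- i.e. m^k L ≤ n^k < (m+1)^k L (k-th powers are monotone on nonnegatives).
IsFloorDiv : (k L n m : ℕ) → Set
IsFloorDiv k L n m = m ^ k * L ≤ n ^ k × n ^ k < suc m ^ k * L

-- (iii) {n/λ} > 1 - j/λ.  With m = ⌊n/λ⌋, {n/λ} = n/λ - m, so the inequality
-- reads n/λ - m > 1 - j/λ, i.e. (n+j)/λ > m+1, i.e. (m+1)^k λ^k < (n+j)^k.
FracCond : (k L n j : ℕ) → Set
FracCond k L n j = Σ ℕ (λ m → IsFloorDiv k L n m × suc m ^ k * L < (n + j) ^ k)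

-- Since λ ≥ 2, consecutive multiples aλ < (a+1)λ are at least 2 apart, so an open
-- interval (n, n+j) with j ≤ 2 contains at most one of them; and it contains one
-- exactly when the first multiple above n, namely (⌊n/λ⌋+1)λ, is below n+j, which
-- is (iii). Nothing about Λ_k beyond λ ≥ 2 is needed, nor k ≥ 2 or n ≥ 1.
module Submission where

open import Defs
open import Data.Nat using (ℕ; zero; suc; _∸_; _+_; _*_; _^_; _≤_; _<_; NonZero; >-nonZero; s≤s; z≤n)
open import Data.Nat.Properties
open import Algebra.Properties.CommutativeSemigroup *-commutativeSemigroup using (interchange)
open import Data.Fin using (Fin; toℕ) renaming (zero to fzero; suc to fsuc)
open import Data.Product using (_×_; _,_)
open import Data.Sum using (_⊎_; inj₁; inj₂)
open import Data.Empty using (⊥)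
open import Function.Bundles using (_⇔_; mk⇔)
open import Relation.Binary.PropositionalEquality using (_≡_; refl; sym; cong; module ≡-Reasoning)

^-distribʳ-* : ∀ m n k → (m * n) ^ k ≡ m ^ k * n ^ k
^-distribʳ-* m n zero    = refl
^-distribʳ-* m n (suc k) = begin
  m * n * (m * n) ^ k       ≡⟨ cong (m * n *_) (^-distribʳ-* m n k) ⟩
  m * n * (m ^ k * n ^ k)   ≡⟨ interchange m n (m ^ k) (n ^ k) ⟩
  m * m ^ k * (n * n ^ k)   ∎
  where open ≡-Reasoning

^-cancelʳ-< : ∀ k {m n} → m ^ k < n ^ k → m < n
^-cancelʳ-< k mᵏ<nᵏ = ≰⇒> (λ n≤m → <⇒≱ mᵏ<nᵏ (^-monoˡ-≤ k n≤m))

prodFin-mono-≤ : ∀ m {f g : Fin m → ℕ} → (∀ i → f i ≤ g i) → prodFin m f ≤ prodFin m g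
prodFin-mono-≤ zero    f≤g = ≤-refl
prodFin-mono-≤ (suc m) f≤g = *-mono-≤ (f≤g fzero) (prodFin-mono-≤ m (λ i → f≤g (fsuc i)))

prodFin-^ : ∀ m (f : Fin m → ℕ) k → prodFin m (λ i → f i ^ k) ≡ prodFin m f ^ k
prodFin-^ zero    f k = sym (^-zeroˡ k)
prodFin-^ (suc m) f k = begin
  f fzero ^ k * prodFin m (λ i → f (fsuc i) ^ k)  ≡⟨ cong (f fzero ^ k *_) (prodFin-^ m (λ i → f (fsuc i)) k) ⟩
  f fzero ^ k * prodFin m (λ i → f (fsuc i)) ^ k  ≡⟨ sym (^-distribʳ-* (f fzero) _ k) ⟩
  (f fzero * prodFin m (λ i → f (fsuc i))) ^ k    ∎
  where open ≡-Reasoning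

2^k≤λpow : ∀ k {b} → InΛParams k b → 2 ^ k ≤ λpow k b
2^k≤λpow k {b} (1≤b , 2≤∏b , _) = begin
  2 ^ k                                    ≤⟨ ^-monoˡ-≤ k 2≤∏b ⟩
  prodFin (k ∸ 1) b ^ k                    ≡⟨ sym (prodFin-^ (k ∸ 1) b k) ⟩
  prodFin (k ∸ 1) (λ i → b i ^ k)          ≤⟨ prodFin-mono-≤ (k ∸ 1) bᵢᵏ≤bᵢᵉ ⟩
  λpow k b                                 ∎
  where
  open ≤-Reasoning
  bᵢᵏ≤bᵢᵉ : ∀ i → b i ^ k ≤ b i ^ (k + suc (toℕ i))
  bᵢᵏ≤bᵢᵉ i = ^-monoʳ-≤ (b i) {{>-nonZero (1≤b i)}} (m≤m+n k _)

*-cross-< : ∀ {x y z w} L .{{_ : NonZero z}} → x < y * L → z * L ≤ w → x * z < w * y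
*-cross-< {x} {y} {z} {w} L x<yL zL≤w = begin-strict
  x * z          <⟨ *-monoˡ-< z x<yL ⟩
  y * L * z      ≡⟨ *-assoc y L z ⟩
  y * (L * z)    ≡⟨ *-comm y (L * z) ⟩
  L * z * y      ≡⟨ cong (_* y) (*-comm L z) ⟩
  z * L * y      ≤⟨ *-monoˡ-≤ y zL≤w ⟩
  w * y          ∎
  where open ≤-Reasoning

consecutive-multiples-∉-window : ∀ k L n a → 2 ^ k ≤ L →
  n ^ k < a ^ k * L → suc a ^ k * L < (n + 2) ^ k → ⊥
consecutive-multiples-∉-window k L n a 2ᵏ≤L lo hi = <-asym n<2a 2a<n
  where
  open ≤-Reasoning
  n[1+a]<[n+2]a : n * suc a < (n + 2) * a
  n[1+a]<[n+2]a = ^-cancelʳ-< k (begin-strict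
    (n * suc a) ^ k          ≡⟨ ^-distribʳ-* n (suc a) k ⟩
    n ^ k * suc a ^ k        <⟨ *-cross-< L {{m^n≢0 (suc a) k}} lo (<⇒≤ hi) ⟩
    (n + 2) ^ k * a ^ k      ≡⟨ sym (^-distribʳ-* (n + 2) a k) ⟩
    ((n + 2) * a) ^ k        ∎)
  n<2a : n < 2 * a
  n<2a = +-cancelˡ-< (n * a) n (2 * a) (begin-strict
    n * a + n                ≡⟨ +-comm (n * a) n ⟩
    n + n * a                ≡⟨ sym (*-suc n a) ⟩
    n * suc a                <⟨ n[1+a]<[n+2]a ⟩
    (n + 2) * a              ≡⟨ *-distribʳ-+ a n 2 ⟩
    n * a + 2 * a            ∎)
  2[1+a]<n+2 : 2 * suc a < n + 2
  2[1+a]<n+2 = ^-cancelʳ-< k (begin-strict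
    (2 * suc a) ^ k          ≡⟨ ^-distribʳ-* 2 (suc a) k ⟩
    2 ^ k * suc a ^ k        ≤⟨ *-monoˡ-≤ (suc a ^ k) 2ᵏ≤L ⟩
    L * suc a ^ k            ≡⟨ *-comm L (suc a ^ k) ⟩
    suc a ^ k * L            <⟨ hi ⟩
    (n + 2) ^ k              ∎)
  2a<n : 2 * a < n
  2a<n = +-cancelˡ-< 2 (2 * a) n (begin-strict
    2 + 2 * a                ≡⟨ sym (*-suc 2 a) ⟩
    2 * suc a                <⟨ 2[1+a]<n+2 ⟩
    n + 2                    ≡⟨ +-comm n 2 ⟩
    2 + n                    ∎)

module _ (k : ℕ) {L : ℕ} (2ᵏ≤L : 2 ^ k ≤ L) (n : ℕ) {j : ℕ} (j≤2 : j ≤ 2) where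

  window-index-≤ : ∀ {a a'} → n ^ k < a ^ k * L → a' ^ k * L < (n + j) ^ k → a' ≤ a
  window-index-≤ {a} {a'} lo hi = ≮⇒≥ λ a<a' →
    consecutive-multiples-∉-window k L n a 2ᵏ≤L lo (begin-strict
      suc a ^ k * L    ≤⟨ *-monoˡ-≤ L (^-monoˡ-≤ k a<a') ⟩
      a' ^ k * L       <⟨ hi ⟩
      (n + j) ^ k      ≤⟨ ^-monoˡ-≤ k (+-monoʳ-≤ n j≤2) ⟩
      (n + 2) ^ k      ∎)
    where open ≤-Reasoning

  window-unique : ∀ {s t} → InWindow k L n j s → InWindow k L n j t → t ≡ s
  window-unique (lo , hi , a , _ , refl) (lo' , hi' , a' , _ , refl) =
    cong (λ c → c ^ k * L) (≤-antisym (window-index-≤ lo hi') (window-index-≤ lo' hi))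

  nonempty⇒cardOne : Nonempty k L n j → CardOne k L n j
  nonempty⇒cardOne (s , s∈W) = s , s∈W , λ t t∈W → window-unique s∈W t∈W

  nonempty⇒fracCond : Nonempty k L n j → FracCond k L n j
  nonempty⇒fracCond (_ , lo , hi , suc m , _ , refl) =
    m , (≮⇒≥ (λ lo' → 1+n≰n (window-index-≤ lo' hi)) , lo) , hi

fracCond⇒nonempty : ∀ k {L n j} → FracCond k L n j → Nonempty k L n j
fracCond⇒nonempty k {L} (m , (_ , lo) , hi) = suc m ^ k * L , lo , hi , suc m , s≤s z≤n , refl

lemma2p3 : (k n : ℕ) → 2 ≤ k → 1 ≤ n → (b : Fin (k ∸ 1) → ℕ) → InΛParams k b →
    (j : ℕ) → j ≡ 1 ⊎ j ≡ 2 →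
      (Nonempty k (λpow k b) n j ⇔ CardOne k (λpow k b) n j)
      × (Nonempty k (λpow k b) n j ⇔ FracCond k (λpow k b) n j)
lemma2p3 k n _ _ b b∈Λ j j∈12 =
  mk⇔ (nonempty⇒cardOne k 2ᵏ≤λᵏ n (j≤2 j∈12)) (λ (s , s∈W , _) → s , s∈W) ,
  mk⇔ (nonempty⇒fracCond k 2ᵏ≤λᵏ n (j≤2 j∈12)) (fracCond⇒nonempty k)
  where
  2ᵏ≤λᵏ : 2 ^ k ≤ λpow k b
  2ᵏ≤λᵏ = 2^k≤λpow k b∈Λ
  j≤2 : ∀ {j} → j ≡ 1 ⊎ j ≡ 2 → j ≤ 2
  j≤2 (inj₁ refl) = s≤s z≤n
  j≤2 (inj₂ refl) = ≤-refl
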